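{- Any algorithm that makes $t$ {\textsc{SET-EVAL}} queries to a given distribution $D$ on $[n]$ can be simulated by an algorithm that makes at most $2^t$ {\textsc{SET-EVAL}} queries to $D$ such that the family of sets it queries is laminar.
   Context: For a distribution $D$ on $[n]=\{1,\dots,n\}$ and $S\subseteq[n]$, $D(S)=\sum_{i\in S}D(i)$. A {\textsc{SET-EVAL}} oracle for $D$ takes as input any $S\subseteq[n]$ and returns $D(S)$; queries may be chosen adaptively. A family of sets is laminar if for any two members $A,B$, either $A\cap B=\emptyset$, $A\subseteq B$, or $B\subseteq A$. "Simulated" means the new algorithm can reproduce the original algorithm's behavior (the values of all its query answers, and hence its output) from the answers to its own queries.
   Formalization: The distribution D takes rational values, and the algorithms branch on rational SET-EVAL answers D(S). -}

module Defs where

open import Data.Nat using (ℕ)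
open import Data.Bool using (Bool; true; false; if_then_else_)
open import Data.Fin using (Fin)
open import Data.Fin.Subset using (Subset; _⊆_; _∩_; Empty; ⊤)
open import Data.Vec using (lookup)
open import Data.List using (List; []; _∷_; _++_; foldr; allFin)
open import Data.List.Membership.Propositional using (_∈_)
open import Data.Rational using (ℚ; 0ℚ; 1ℚ; _+_; _≤_)
open import Data.Sum using (_⊎_)
open import Relation.Binary.PropositionalEquality using (_≡_)

mass : ∀ {n} → (Fin n → ℚ) → Subset n → ℚ
mass {n} D S = foldr (λ i acc → (if lookup S i then D i else 0ℚ) + acc) 0ℚ (allFin n)

record Distribution (n : ℕ) : Set where
  field
    prob    : Fin n → ℚ
    nonneg  : ∀ i → 0ℚ ≤ prob i
    sumsTo1 : mass prob ⊤ ≡ 1ℚ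
open Distribution public

-- An adaptive SET-EVAL query algorithm with output type Out: a decision tree
-- that either stops with an output or queries a set S and continues
-- depending on the answer D(S).
data Alg (n : ℕ) (Out : Set) : Set where
  ret : Out → Alg n Out
  ask : Subset n → (ℚ → Alg n Out) → Alg n Out

setEval : ∀ {n} → Distribution n → Subset n → ℚ
setEval D S = mass (prob D) S

run : ∀ {n Out} → Alg n Out → Distribution n → Out
run (ret o)   D = o
run (ask S k) D = run (k (setEval D S)) D

queries : ∀ {n Out} → Alg n Out → Distribution n → List (Subset n)
queries (ret o)   D = []
queries (ask S k) D = S ∷ queries (k (setEval D S)) D

Laminar : ∀ {n} → List (Subset n) → Set
Laminar F = ∀ {A B} → A ∈ F → B ∈ F → Empty (A ∩ B) ⊎ (A ⊆ B ⊎ B ⊆ A)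

-- The simulation keeps the atoms of the Venn diagram of the sets queried so
-- far; they partition [n].  A query S is answered by asking D(S ∩ C) for every
-- atom C and adding up, which costs 2^i queries at step i and 2^t − 1 in all.
-- Each set asked is an atom of the diagram refined by S, and since every
-- diagram refines the previous ones, atoms of different steps are either
-- disjoint or nested.
module Submission where

open import Defs
open import Data.Nat using (ℕ; _≤_; _^_)
open import Data.List using (length)
open import Data.Product using (Σ; _×_)
open import Relation.Binary.PropositionalEquality using (_≡_)

open import Algebra.Bundles using (CommutativeMonoid)
open import Data.Bool using (true; false; _∧_; not; if_then_else_)
open import Data.Fin using (Fin)
open import Data.Fin.Subset using (Subset; ∁; _∩_; _⊆_; Empty; ⊤)
open import Data.Fin.Subset.Properties
  using (⊆-trans; ∩-assoc; ∩-comm; ∩-identityʳ; p∩q⊆p; p∩q⊆q; x∈p∩q⁺; x∈p∩q⁻; x∈p⇒x∉∁p)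
open import Data.List using (List; []; _∷_; _++_; map; foldr; allFin)
open import Data.List.Membership.Propositional using (_∈_; find; lose)
open import Data.List.Membership.Propositional.Properties using (∈-++⁻; ∈-++⁺ˡ; ∈-map⁻)
open import Data.List.Properties using (length-++; length-map)
open import Data.List.Relation.Unary.Any as Any using (Any; here)
open import Data.Nat using (_+_; _*_; suc)
open import Data.Nat.Properties
  using (module ≤-Reasoning; ≤-trans; ≤-reflexive; m≤m+n; +-suc; +-identityʳ; ^-monoʳ-≤)
open import Data.Nat.Tactic.RingSolver using (solve-∀)
open import Data.Product using (_,_)
open import Data.Rational using (ℚ; 0ℚ) renaming (_+_ to _+ℚ_)
open import Data.Rational.Properties using (+-0-commutativeMonoid)
  renaming (+-assoc to +ℚ-assoc; +-identityˡ to +ℚ-identityˡ; +-identityʳ to +ℚ-identityʳ)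
open import Algebra.Properties.CommutativeSemigroup
  (CommutativeMonoid.commutativeSemigroup +-0-commutativeMonoid) using (interchange)
open import Data.Sum using (_⊎_; inj₁; inj₂)
open import Data.Vec using (lookup)
open import Data.Vec.Properties using (lookup-map; lookup-zipWith)
open import Function using (id; _∘_)
open import Relation.Binary.PropositionalEquality
  using (refl; sym; trans; cong; cong₂; subst; module ≡-Reasoning)

∑ : ∀ {A : Set} → List A → (A → ℚ) → ℚ
∑ xs f = foldr (λ x acc → f x +ℚ acc) 0ℚ xs

module _ {A : Set} where

  ∑-cong : ∀ (xs : List A) {f g : A → ℚ} → (∀ x → f x ≡ g x) → ∑ xs f ≡ ∑ xs g
  ∑-cong []       f≗g = refl
  ∑-cong (x ∷ xs) f≗g = cong₂ _+ℚ_ (f≗g x) (∑-cong xs f≗g)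

  ∑-++ : ∀ (xs ys : List A) (f : A → ℚ) → ∑ (xs ++ ys) f ≡ ∑ xs f +ℚ ∑ ys f
  ∑-++ []       ys f = sym (+ℚ-identityˡ _)
  ∑-++ (x ∷ xs) ys f = trans (cong (f x +ℚ_) (∑-++ xs ys f)) (sym (+ℚ-assoc (f x) _ _))

  ∑-map : ∀ {B : Set} (g : B → A) (xs : List B) (f : A → ℚ) → ∑ (map g xs) f ≡ ∑ xs (f ∘ g)
  ∑-map g []       f = refl
  ∑-map g (x ∷ xs) f = cong (f (g x) +ℚ_) (∑-map g xs f)

  ∑-+ : ∀ (xs : List A) {f g h : A → ℚ} → (∀ x → f x +ℚ g x ≡ h x) → ∑ xs f +ℚ ∑ xs g ≡ ∑ xs h
  ∑-+ []       f+g≗h = +ℚ-identityˡ 0ℚ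
  ∑-+ (x ∷ xs) {f} {g} f+g≗h =
    trans (interchange (f x) (∑ xs f) (g x) (∑ xs g)) (cong₂ _+ℚ_ (f+g≗h x) (∑-+ xs {f} {g} f+g≗h))

module _ {n : ℕ} where

  weight : (Fin n → ℚ) → Subset n → Fin n → ℚ
  weight d S i = if lookup S i then d i else 0ℚ

  weight-split : ∀ d X S i → weight d (X ∩ S) i +ℚ weight d (X ∩ ∁ S) i ≡ weight d X i
  weight-split d X S i
    rewrite lookup-zipWith _∧_ i X S | lookup-zipWith _∧_ i X (∁ S) | lookup-map i not S
    with lookup X i | lookup S i
  ... | true  | true  = +ℚ-identityʳ (d i)
  ... | true  | false = +ℚ-identityˡ (d i)
  ... | false | _     = +ℚ-identityˡ 0ℚ

  mass-split : ∀ (d : Fin n → ℚ) X S → mass d (X ∩ S) +ℚ mass d (X ∩ ∁ S) ≡ mass d X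
  mass-split d X S = ∑-+ (allFin n) {weight d (X ∩ S)} {weight d (X ∩ ∁ S)} (weight-split d X S)

  Nested : Subset n → Subset n → Set
  Nested A B = Empty (A ∩ B) ⊎ (A ⊆ B ⊎ B ⊆ A)

  DisjointOrEqual : List (Subset n) → Set
  DisjointOrEqual P = ∀ {X Y} → X ∈ P → Y ∈ P → X ≡ Y ⊎ Empty (X ∩ Y)

  Empty-∩-comm : ∀ {A B : Subset n} → Empty (A ∩ B) → Empty (B ∩ A)
  Empty-∩-comm {A} {B} = subst Empty (∩-comm A B)

  Empty-∩-mono : ∀ {A A′ B B′ : Subset n} → A′ ⊆ A → B′ ⊆ B → Empty (A ∩ B) → Empty (A′ ∩ B′)
  Empty-∩-mono {A′ = A′} {B′ = B′} A′⊆A B′⊆B A∩B-empty (x , x∈A′∩B′) =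
    let x∈A′ , x∈B′ = x∈p∩q⁻ A′ B′ x∈A′∩B′ in A∩B-empty (x , x∈p∩q⁺ (A′⊆A x∈A′ , B′⊆B x∈B′))

  Empty-∩-∁ : ∀ (S : Subset n) → Empty (S ∩ ∁ S)
  Empty-∩-∁ S (x , x∈S∩∁S) = let x∈S , x∈∁S = x∈p∩q⁻ S (∁ S) x∈S∩∁S in x∈p⇒x∉∁p x∈S x∈∁S

  Nested-sym : ∀ {A B : Subset n} → Nested A B → Nested B A
  Nested-sym (inj₁ A∩B-empty)  = inj₁ (Empty-∩-comm A∩B-empty)
  Nested-sym (inj₂ (inj₁ A⊆B)) = inj₂ (inj₂ A⊆B)
  Nested-sym (inj₂ (inj₂ B⊆A)) = inj₂ (inj₁ B⊆A)

  disjointOrEqual⇒nested : ∀ {A B : Subset n} → A ≡ B ⊎ Empty (A ∩ B) → Nested A B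
  disjointOrEqual⇒nested (inj₁ refl)      = inj₂ (inj₁ id)
  disjointOrEqual⇒nested (inj₂ A∩B-empty) = inj₁ A∩B-empty

  nested-below : ∀ {P : List (Subset n)} {X Y} → DisjointOrEqual P → X ∈ P → Any (Y ⊆_) P → Nested X Y
  nested-below P-doe X∈P Y-below with find Y-below
  ... | Z , Z∈P , Y⊆Z with P-doe X∈P Z∈P
  ...   | inj₁ refl      = inj₂ (inj₂ Y⊆Z)
  ...   | inj₂ X∩Z-empty = inj₁ (Empty-∩-mono id Y⊆Z X∩Z-empty)

  laminar-++ : ∀ {P} F {G} → DisjointOrEqual P → (∀ {X} → X ∈ F → X ∈ P) →
               Laminar G → (∀ {Y} → Y ∈ G → Any (Y ⊆_) P) → Laminar (F ++ G)
  laminar-++ F P-doe F⊆P G-laminar G-below A∈F++G B∈F++G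
    with ∈-++⁻ F A∈F++G | ∈-++⁻ F B∈F++G
  ... | inj₁ A∈F | inj₁ B∈F = disjointOrEqual⇒nested (P-doe (F⊆P A∈F) (F⊆P B∈F))
  ... | inj₁ A∈F | inj₂ B∈G = nested-below P-doe (F⊆P A∈F) (G-below B∈G)
  ... | inj₂ A∈G | inj₁ B∈F = Nested-sym (nested-below P-doe (F⊆P B∈F) (G-below A∈G))
  ... | inj₂ A∈G | inj₂ B∈G = G-laminar A∈G B∈G

  atoms : List (Subset n) → List (Subset n)
  atoms []      = ⊤ ∷ []
  atoms (S ∷ h) = map (S ∩_) (atoms h) ++ map (∁ S ∩_) (atoms h)

  length-atoms : ∀ h → length (atoms h) ≡ 2 ^ length h
  length-atoms []      = refl
  length-atoms (S ∷ h) = begin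
    length (map (S ∩_) (atoms h) ++ map (∁ S ∩_) (atoms h))
      ≡⟨ length-++ (map (S ∩_) (atoms h)) ⟩
    length (map (S ∩_) (atoms h)) + length (map (∁ S ∩_) (atoms h))
      ≡⟨ cong₂ _+_ (length-map (S ∩_) (atoms h)) (length-map (∁ S ∩_) (atoms h)) ⟩
    length (atoms h) + length (atoms h)
      ≡⟨ cong (λ a → a + a) (length-atoms h) ⟩
    2 ^ length h + 2 ^ length h
      ≡⟨ cong (2 ^ length h +_) (sym (+-identityʳ _)) ⟩
    2 ^ suc (length h) ∎
    where open ≡-Reasoning

  ∑-atoms-mass : ∀ (d : Fin n → ℚ) h X → ∑ (atoms h) (λ C → mass d (X ∩ C)) ≡ mass d X
  ∑-atoms-mass d []      X = trans (+ℚ-identityʳ _) (cong (mass d) (∩-identityʳ X))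
  ∑-atoms-mass d (S ∷ h) X = begin
    ∑ (map (S ∩_) (atoms h) ++ map (∁ S ∩_) (atoms h)) (λ C → mass d (X ∩ C))
      ≡⟨ ∑-++ (map (S ∩_) (atoms h)) (map (∁ S ∩_) (atoms h)) (λ C → mass d (X ∩ C)) ⟩
    ∑ (map (S ∩_) (atoms h)) (λ C → mass d (X ∩ C)) +ℚ ∑ (map (∁ S ∩_) (atoms h)) (λ C → mass d (X ∩ C))
      ≡⟨ cong₂ _+ℚ_ (restrict S) (restrict (∁ S)) ⟩
    mass d (X ∩ S) +ℚ mass d (X ∩ ∁ S)
      ≡⟨ mass-split d X S ⟩
    mass d X ∎
    where
    open ≡-Reasoning
    restrict : ∀ T → ∑ (map (T ∩_) (atoms h)) (λ C → mass d (X ∩ C)) ≡ mass d (X ∩ T)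
    restrict T = begin
      ∑ (map (T ∩_) (atoms h)) (λ C → mass d (X ∩ C))
        ≡⟨ ∑-map (T ∩_) (atoms h) (λ C → mass d (X ∩ C)) ⟩
      ∑ (atoms h) (λ C → mass d (X ∩ (T ∩ C)))
        ≡⟨ ∑-cong (atoms h) (λ C → cong (mass d) (sym (∩-assoc X T C))) ⟩
      ∑ (atoms h) (λ C → mass d ((X ∩ T) ∩ C))
        ≡⟨ ∑-atoms-mass d h (X ∩ T) ⟩
      mass d (X ∩ T) ∎

  atoms-disjointOrEqual : ∀ h → DisjointOrEqual (atoms h)
  atoms-disjointOrEqual []      (here refl) (here refl) = inj₁ refl
  atoms-disjointOrEqual (S ∷ h) X∈ Y∈ =
    by-sides (∈-++⁻ (map (S ∩_) (atoms h)) X∈) (∈-++⁻ (map (S ∩_) (atoms h)) Y∈)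
    where
    same-side : ∀ T {X Y} → X ∈ map (T ∩_) (atoms h) → Y ∈ map (T ∩_) (atoms h) → X ≡ Y ⊎ Empty (X ∩ Y)
    same-side T X∈ Y∈ with ∈-map⁻ (T ∩_) X∈ | ∈-map⁻ (T ∩_) Y∈
    ... | C , C∈ , refl | C′ , C′∈ , refl with atoms-disjointOrEqual h C∈ C′∈
    ...   | inj₁ refl       = inj₁ refl
    ...   | inj₂ C∩C′-empty = inj₂ (Empty-∩-mono (p∩q⊆q T C) (p∩q⊆q T C′) C∩C′-empty)
    opposite-sides : ∀ T T′ {X Y} → Empty (T ∩ T′) →
                     X ∈ map (T ∩_) (atoms h) → Y ∈ map (T′ ∩_) (atoms h) → Empty (X ∩ Y)
    opposite-sides T T′ T∩T′-empty X∈ Y∈ with ∈-map⁻ (T ∩_) X∈ | ∈-map⁻ (T′ ∩_) Y∈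
    ... | C , _ , refl | C′ , _ , refl = Empty-∩-mono (p∩q⊆p T C) (p∩q⊆p T′ C′) T∩T′-empty
    by-sides : ∀ {X Y} →
               X ∈ map (S ∩_) (atoms h) ⊎ X ∈ map (∁ S ∩_) (atoms h) →
               Y ∈ map (S ∩_) (atoms h) ⊎ Y ∈ map (∁ S ∩_) (atoms h) → X ≡ Y ⊎ Empty (X ∩ Y)
    by-sides (inj₁ X∈) (inj₁ Y∈) = same-side S X∈ Y∈
    by-sides (inj₂ X∈) (inj₂ Y∈) = same-side (∁ S) X∈ Y∈
    by-sides (inj₁ X∈) (inj₂ Y∈) = inj₂ (opposite-sides S (∁ S) (Empty-∩-∁ S) X∈ Y∈)
    by-sides (inj₂ X∈) (inj₁ Y∈) = inj₂ (opposite-sides (∁ S) S (Empty-∩-comm (Empty-∩-∁ S)) X∈ Y∈)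

  map-∩-below : ∀ T (P : List (Subset n)) {X} → X ∈ map (T ∩_) P → Any (X ⊆_) P
  map-∩-below T P X∈ with ∈-map⁻ (T ∩_) X∈
  ... | C , C∈P , refl = lose C∈P (p∩q⊆q T C)

  atoms-refine : ∀ S h {X} → X ∈ atoms (S ∷ h) → Any (X ⊆_) (atoms h)
  atoms-refine S h X∈ with ∈-++⁻ (map (S ∩_) (atoms h)) X∈
  ... | inj₁ X∈S∩  = map-∩-below S (atoms h) X∈S∩
  ... | inj₂ X∈∁S∩ = map-∩-below (∁ S) (atoms h) X∈∁S∩

  below-refine : ∀ S h {Y} → Any (Y ⊆_) (atoms (S ∷ h)) → Any (Y ⊆_) (atoms h)
  below-refine S h Y-below with find Y-below
  ... | Z , Z∈ , Y⊆Z = Any.map (⊆-trans Y⊆Z) (atoms-refine S h Z∈)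

+-regroup : ∀ a r → (a + r) + a ≡ r + 2 * a
+-regroup = solve-∀

module _ {n : ℕ} {Out : Set} where

  askSum : List (Subset n) → (ℚ → Alg n Out) → Alg n Out
  askSum []       k = k 0ℚ
  askSum (S ∷ Ss) k = ask S (λ q → askSum Ss (λ r → k (q +ℚ r)))

  run-askSum : ∀ Ss k D → run (askSum Ss k) D ≡ run (k (∑ Ss (setEval D))) D
  run-askSum []       k D = refl
  run-askSum (S ∷ Ss) k D = run-askSum Ss (λ r → k (setEval D S +ℚ r)) D

  queries-askSum : ∀ Ss k D → queries (askSum Ss k) D ≡ Ss ++ queries (k (∑ Ss (setEval D))) D
  queries-askSum []       k D = refl
  queries-askSum (S ∷ Ss) k D = cong (S ∷_) (queries-askSum Ss (λ r → k (setEval D S +ℚ r)) D)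

  -- The history h lists the sets queried so far, most recent first.
  simulate : List (Subset n) → Alg n Out → Alg n Out
  simulate h (ret o)   = ret o
  simulate h (ask S k) = askSum (map (S ∩_) (atoms h)) (λ v → simulate (S ∷ h) (k v))

  ∑-setEval-atoms : ∀ (D : Distribution n) h S → ∑ (map (S ∩_) (atoms h)) (setEval D) ≡ setEval D S
  ∑-setEval-atoms D h S = trans (∑-map (S ∩_) (atoms h) (setEval D)) (∑-atoms-mass (prob D) h S)

  run-simulate : ∀ h A D → run (simulate h A) D ≡ run A D
  run-simulate h (ret o)   D = refl
  run-simulate h (ask S k) D = begin
    run (askSum (map (S ∩_) (atoms h)) (λ v → simulate (S ∷ h) (k v))) D
      ≡⟨ run-askSum (map (S ∩_) (atoms h)) (λ v → simulate (S ∷ h) (k v)) D ⟩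
    run (simulate (S ∷ h) (k (∑ (map (S ∩_) (atoms h)) (setEval D)))) D
      ≡⟨ cong (λ v → run (simulate (S ∷ h) (k v)) D) (∑-setEval-atoms D h S) ⟩
    run (simulate (S ∷ h) (k (setEval D S))) D
      ≡⟨ run-simulate (S ∷ h) (k (setEval D S)) D ⟩
    run (k (setEval D S)) D ∎
    where open ≡-Reasoning

  queries-simulate-ask : ∀ h S k D → queries (simulate h (ask S k)) D
                         ≡ map (S ∩_) (atoms h) ++ queries (simulate (S ∷ h) (k (setEval D S))) D
  queries-simulate-ask h S k D = begin
    queries (askSum (map (S ∩_) (atoms h)) (λ v → simulate (S ∷ h) (k v))) D
      ≡⟨ queries-askSum (map (S ∩_) (atoms h)) (λ v → simulate (S ∷ h) (k v)) D ⟩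
    map (S ∩_) (atoms h) ++ queries (simulate (S ∷ h) (k (∑ (map (S ∩_) (atoms h)) (setEval D)))) D
      ≡⟨ cong (λ v → map (S ∩_) (atoms h) ++ queries (simulate (S ∷ h) (k v)) D) (∑-setEval-atoms D h S) ⟩
    map (S ∩_) (atoms h) ++ queries (simulate (S ∷ h) (k (setEval D S))) D ∎
    where open ≡-Reasoning

  length-simulate : ∀ h A D →
    length (queries (simulate h A) D) + 2 ^ length h ≤ 2 ^ (length h + length (queries A D))
  length-simulate h (ret o)   D = ≤-reflexive (cong (2 ^_) (sym (+-identityʳ (length h))))
  length-simulate h (ask S k) D = begin
    length (queries (simulate h (ask S k)) D) + 2 ^ L
      ≡⟨ cong (λ qs → length qs + 2 ^ L) (queries-simulate-ask h S k D) ⟩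
    length (map (S ∩_) (atoms h) ++ rest) + 2 ^ L
      ≡⟨ cong (_+ 2 ^ L) (length-++ (map (S ∩_) (atoms h))) ⟩
    (length (map (S ∩_) (atoms h)) + length rest) + 2 ^ L
      ≡⟨ cong (λ a → (a + length rest) + 2 ^ L) (trans (length-map (S ∩_) (atoms h)) (length-atoms h)) ⟩
    (2 ^ L + length rest) + 2 ^ L
      ≡⟨ +-regroup (2 ^ L) (length rest) ⟩
    length rest + 2 * 2 ^ L
      ≤⟨ length-simulate (S ∷ h) (k (setEval D S)) D ⟩
    2 ^ (suc L + length (queries (k (setEval D S)) D))
      ≡⟨ cong (2 ^_) (sym (+-suc L _)) ⟩
    2 ^ (L + suc (length (queries (k (setEval D S)) D))) ∎
    where
    open ≤-Reasoning
    L : ℕ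
    L = length h
    rest : List (Subset n)
    rest = queries (simulate (S ∷ h) (k (setEval D S))) D

  queries-simulate-below : ∀ h A (D : Distribution n) {Y} →
                           Y ∈ queries (simulate h A) D → Any (Y ⊆_) (atoms h)
  queries-simulate-below h (ret o)   D ()
  queries-simulate-below h (ask S k) D Y∈
    rewrite queries-simulate-ask h S k D
    with ∈-++⁻ (map (S ∩_) (atoms h)) Y∈
  ... | inj₁ Y∈now   = map-∩-below S (atoms h) Y∈now
  ... | inj₂ Y∈later = below-refine S h (queries-simulate-below (S ∷ h) (k (setEval D S)) D Y∈later)

  laminar-simulate : ∀ h A (D : Distribution n) → Laminar (queries (simulate h A) D)
  laminar-simulate h (ret o)   D ()
  laminar-simulate h (ask S k) D
    rewrite queries-simulate-ask h S k D =
    laminar-++ (map (S ∩_) (atoms h)) (atoms-disjointOrEqual (S ∷ h)) ∈-++⁺ˡ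
      (laminar-simulate (S ∷ h) (k (setEval D S)) D)
      (queries-simulate-below (S ∷ h) (k (setEval D S)) D)

lemma3p3 : ∀ {n : ℕ} {Out : Set} (t : ℕ) (A : Alg n Out)
    → (∀ (D : Distribution n) → length (queries A D) ≤ t)
    → Σ (Alg n Out) (λ B → ∀ (D : Distribution n)
        → run B D ≡ run A D
        × length (queries B D) ≤ 2 ^ t
        × Laminar (queries B D))
lemma3p3 t A query-bound = simulate [] A , λ D →
  run-simulate [] A D ,
  ≤-trans (m≤m+n _ 1) (≤-trans (length-simulate [] A D) (^-monoʳ-≤ 2 (query-bound D))) ,
  laminar-simulate [] A D
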